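{- Let $\Delta\subseteq\Gamma$ be simplicial complexes on $\{1,\ldots,K\}$ and $\mathbf{n}$ a table. Then \[F^\Delta_{\mathbf{n}}=\pi\bigl(F^\Gamma_{\mathbf{n}}\cap\{\mathbf{c}: \mathbf{c}^F=0 \text{ for all } F\in\Gamma\setminus\Delta\}\bigr),\] where $\pi$ is the coordinate projection from the ambient space of $F^\Gamma_{\mathbf{n}}$ onto the ambient space of $F^\Delta_{\mathbf{n}}$ (forgetting the coordinates indexed by faces in $\Gamma\setminus\Delta$), and $\mathbf{c}^F$ denotes the block of coordinates of $\mathbf{c}$ indexed by the face $F$.
   Context: Random variables $X_1,\ldots,X_K$ with $X_j$ taking values in $[d_j]$; cells $d=\bigotimes_j[d_j]$; a table $\mathbf{n}\in\mathbb{R}^d$. For $F\subseteq\{1,\ldots,K\}$, $d_F=\bigotimes_{j\in F}[d_j]$ and $i_F$ is the restriction of $i\in d$ to $F$. For a simplicial complex $\Sigma$, the matrix $A_\Sigma$ has columns indexed by $d$ and rows indexed by pairs $(F,j_F)$ with $F$ a face of $\Sigma$ and $j_F\in d_F$; row $(F,j_F)$ is the indicator vector of $\{i\in d: i_F=j_F\}$. Thus a vector $\mathbf{c}$ in the row-index space of $A_\Sigma$ splits into blocks $\mathbf{c}^F$, one for each face $F$ of $\Sigma$. With $\mathbf{t}=A_\Sigma\mathbf{n}$, define $F^\Sigma_{\mathbf{n}}=\{\mathbf{c}: \mathbf{c}^T\mathbf{a}\le\mathbf{c}^T\mathbf{t}\text{ for every column }\mathbf{a}\text{ of }A_\Sigma\}$.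 -}

module Defs where

open import Level using (Level; _⊔_)
open import Data.Nat using (ℕ; zero; suc)
open import Data.Bool using (Bool; true; false; _∧_; if_then_else_)
open import Data.Unit.Polymorphic using (⊤; tt)
open import Data.Product using (_×_; _,_; Σ)
open import Data.Fin using (Fin; zero; suc)
open import Data.Fin.Subset using (Subset; inside; outside; _⊆_)
open import Data.Vec using (Vec; []; _∷_)
open import Data.List using (List; []; _∷_; map; foldr; filterᵇ; cartesianProduct; allFin)
open import Relation.Binary.PropositionalEquality using (_≡_)
open import Relation.Binary.Core using (Rel)
open import Relation.Binary.Structures using (IsTotalOrder)
open import Relation.Nullary.Decidable using (⌊_⌋)
open import Algebra.Bundles using (CommutativeRing)
import Data.Fin as Fin

-- Cells and marginal cells.
-- Variables X_1..X_K are indexed by Fin K; X_j takes values in Fin (d j).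

Cell : (K : ℕ) → (Fin K → ℕ) → Set
Cell zero    d = ⊤
Cell (suc K) d = Fin (d zero) × Cell K (λ j → d (suc j))

MCell : {K : ℕ} → (Fin K → ℕ) → Subset K → Set
MCell d []            = ⊤
MCell d (inside ∷ F)  = Fin (d zero) × MCell (λ j → d (suc j)) F
MCell d (outside ∷ F) = MCell (λ j → d (suc j)) F

restrict : {K : ℕ} {d : Fin K → ℕ} (F : Subset K) → Cell K d → MCell d F
restrict []            _       = tt
restrict (inside ∷ F)  (x , i) = x , restrict F i
restrict (outside ∷ F) (x , i) = restrict F i

mcell-eq : {K : ℕ} {d : Fin K → ℕ} (F : Subset K) → MCell d F → MCell d F → Bool
mcell-eq []            _       _       = true
mcell-eq (inside ∷ F)  (x , a) (y , b) = ⌊ x Fin.≟ y ⌋ ∧ mcell-eq F a b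
mcell-eq (outside ∷ F) a       b       = mcell-eq F a b

allCells : (K : ℕ) (d : Fin K → ℕ) → List (Cell K d)
allCells zero    d = tt ∷ []
allCells (suc K) d = cartesianProduct (allFin (d zero)) (allCells K (λ j → d (suc j)))

allMCells : {K : ℕ} (d : Fin K → ℕ) (F : Subset K) → List (MCell d F)
allMCells d []            = tt ∷ []
allMCells d (inside ∷ F)  = cartesianProduct (allFin (d zero)) (allMCells (λ j → d (suc j)) F)
allMCells d (outside ∷ F) = allMCells (λ j → d (suc j)) F

allSubsets : (K : ℕ) → List (Subset K)
allSubsets zero    = [] ∷ []
allSubsets (suc K) = map (inside ∷_) (allSubsets K) Data.List.++ map (outside ∷_) (allSubsets K)

record SimplicialComplex (K : ℕ) : Set where
  field
    face   : Subset K → Bool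
    closed : ∀ {F G} → G ⊆ F → face F ≡ true → face G ≡ true
open SimplicialComplex public

faces : {K : ℕ} → SimplicialComplex K → List (Subset K)
faces {K} Σc = filterᵇ (face Σc) (allSubsets K)

_⊑_ : {K : ℕ} → SimplicialComplex K → SimplicialComplex K → Set
Δ ⊑ Γ = ∀ F → face Δ F ≡ true → face Γ F ≡ true

-- Ordered commutative rings (scalars; ℝ is an instance).

record OrderedCommRing (c ℓ ℓ' : Level) : Set (Level.suc (c ⊔ ℓ ⊔ ℓ')) where
  field
    commRing : CommutativeRing c ℓ
  open CommutativeRing commRing public
  field
    _≤_        : Rel Carrier ℓ'
    isTotalOrder : IsTotalOrder _≈_ _≤_
    +-mono-≤   : ∀ {x y} z → x ≤ y → (x + z) ≤ (y + z)
    *-nonneg   : ∀ {x y} → 0# ≤ x → 0# ≤ y → 0# ≤ (x * y)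

module Tables {c ℓ ℓ'} (R : OrderedCommRing c ℓ ℓ') {K : ℕ} (d : Fin K → ℕ) where
  open OrderedCommRing R

  sumL : {A : Set} → (A → Carrier) → List A → Carrier
  sumL f = foldr (λ a s → f a + s) 0#

  Table : Set c
  Table = Cell K d → Carrier

  -- vectors in the row-index space; only coordinates (F , j_F) with F a
  -- face of the complex under consideration are relevant.
  RowVec : Set c
  RowVec = (F : Subset K) → MCell d F → Carrier

  A : (F : Subset K) → MCell d F → Cell K d → Carrier
  A F jF i = if mcell-eq F (restrict F i) jF then 1# else 0#

  dotCol : SimplicialComplex K → RowVec → Cell K d → Carrier
  dotCol Σc cv i = sumL (λ F → sumL (λ jF → cv F jF * A F jF i) (allMCells d F)) (faces Σc)

  t : Table → (F : Subset K) → MCell d F → Carrier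
  t n F jF = sumL (λ i → A F jF i * n i) (allCells K d)

  dotT : SimplicialComplex K → RowVec → Table → Carrier
  dotT Σc cv n = sumL (λ F → sumL (λ jF → cv F jF * t n F jF) (allMCells d F)) (faces Σc)

  InF : SimplicialComplex K → Table → RowVec → Set ℓ'
  InF Σc n cv = ∀ (i : Cell K d) → dotCol Σc cv i ≤ dotT Σc cv n

{-# OPTIONS --safe #-}
-- Both sides of every defining inequality of F^Σ_n are pairings ⟨c , w⟩_Σ of c with a
-- vector w (a column of A_Σ, or t = A_Σ n) summed over the faces of Σ. If c' vanishes on
-- the faces of Γ ∖ Δ and agrees with c on Δ, then ⟨c' , w⟩_Γ = ⟨c , w⟩_Δ for every w, so
-- c' ∈ F^Γ_n iff c ∈ F^Δ_n; and every c has such a c', namely its extension by zero.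
module Submission where

open import Defs
open import Data.Nat using (ℕ)
open import Data.Bool using (true; false; if_then_else_)
open import Data.Fin using (Fin)
open import Data.Fin.Subset using (Subset)
open import Data.List using ([]; _∷_; filterᵇ)
open import Data.Product using (_×_; _,_; Σ)
open import Relation.Binary.PropositionalEquality as ≡ using (_≡_)
open import Relation.Binary.Structures using (IsTotalOrder)
open import Function.Bundles using (_⇔_; mk⇔; module Equivalence)

module Pairing {c ℓ ℓ'} (R : OrderedCommRing c ℓ ℓ') {K : ℕ} (d : Fin K → ℕ) where
  open OrderedCommRing R
  open Tables R d

  sumL-cong : {A : Set} {f g : A → Carrier} → (∀ a → f a ≈ g a) → ∀ xs → sumL f xs ≈ sumL g xs
  sumL-cong f≈g []       = refl
  sumL-cong f≈g (x ∷ xs) = +-cong (f≈g x) (sumL-cong f≈g xs)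

  sumL-zero : {A : Set} {f : A → Carrier} → (∀ a → f a ≈ 0#) → ∀ xs → sumL f xs ≈ 0#
  sumL-zero f≈0 []       = refl
  sumL-zero f≈0 (x ∷ xs) = trans (+-cong (f≈0 x) (sumL-zero f≈0 xs)) (+-identityˡ 0#)

  ≤-resp-≈₂ : ∀ {a b x y} → a ≈ x → b ≈ y → a ≤ b → x ≤ y
  ≤-resp-≈₂ a≈x b≈y a≤b = ≲-respˡ-≈ a≈x (≲-respʳ-≈ b≈y a≤b)
    where open IsTotalOrder isTotalOrder using (≲-respˡ-≈; ≲-respʳ-≈)

  blockPairing : RowVec → RowVec → Subset K → Carrier
  blockPairing cv w F = sumL (λ jF → cv F jF * w F jF) (allMCells d F)

  pairing : SimplicialComplex K → RowVec → RowVec → Carrier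
  pairing Σc cv w = sumL (blockPairing cv w) (faces Σc)

  blockPairing-cong : ∀ cv cv' w F → (∀ jF → cv F jF ≈ cv' F jF) →
                      blockPairing cv w F ≈ blockPairing cv' w F
  blockPairing-cong cv cv' w F cv≈cv' = sumL-cong (λ jF → *-congʳ (cv≈cv' jF)) (allMCells d F)

  blockPairing-zero : ∀ cv w F → (∀ jF → cv F jF ≈ 0#) → blockPairing cv w F ≈ 0#
  blockPairing-zero cv w F cv≈0 =
    sumL-zero (λ jF → trans (*-congʳ (cv≈0 jF)) (zeroˡ _)) (allMCells d F)

  ZeroOn_∖_ : SimplicialComplex K → SimplicialComplex K → RowVec → Set ℓ
  (ZeroOn Γ ∖ Δ) c' = ∀ F → face Γ F ≡ true → face Δ F ≡ false → ∀ jF → c' F jF ≈ 0#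

  AgreeOn : SimplicialComplex K → RowVec → RowVec → Set ℓ
  AgreeOn Δ c' cv = ∀ F → face Δ F ≡ true → ∀ jF → c' F jF ≈ cv F jF

  extendByZero : SimplicialComplex K → RowVec → RowVec
  extendByZero Δ cv F jF = if face Δ F then cv F jF else 0#

  extendByZero-zeroOn : ∀ Δ Γ cv → (ZeroOn Γ ∖ Δ) (extendByZero Δ cv)
  extendByZero-zeroOn Δ Γ cv F _ F∉Δ jF rewrite F∉Δ = refl

  extendByZero-agreeOn : ∀ Δ cv → AgreeOn Δ (extendByZero Δ cv) cv
  extendByZero-agreeOn Δ cv F F∈Δ jF rewrite F∈Δ = refl

  module _ (Δ Γ : SimplicialComplex K) (Δ⊑Γ : Δ ⊑ Γ) (c' cv : RowVec)
           (zeroOn : (ZeroOn Γ ∖ Δ) c') (agreeOn : AgreeOn Δ c' cv) where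

    filter-pairing : ∀ w Fs → sumL (blockPairing c' w) (filterᵇ (face Γ) Fs)
                                ≈ sumL (blockPairing cv w) (filterᵇ (face Δ) Fs)
    filter-pairing w [] = refl
    filter-pairing w (F ∷ Fs) with face Γ F in F∈Γ | face Δ F in F∈Δ
    ... | true  | true  = +-cong (blockPairing-cong c' cv w F (agreeOn F F∈Δ)) (filter-pairing w Fs)
    ... | true  | false = trans (+-cong (blockPairing-zero c' w F (zeroOn F F∈Γ F∈Δ))
                                        (filter-pairing w Fs))
                                (+-identityˡ _)
    ... | false | true  with () ← ≡.trans (≡.sym (Δ⊑Γ F F∈Δ)) F∈Γ
    ... | false | false = filter-pairing w Fs

    pairing-extension : ∀ w → pairing Γ c' w ≈ pairing Δ cv w
    pairing-extension w = filter-pairing w (allSubsets K)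

    InF-extension : ∀ n → InF Γ n c' ⇔ InF Δ n cv
    InF-extension n = mk⇔
      (λ c'∈F i → ≤-resp-≈₂ (column i) marginals (c'∈F i))
      (λ cv∈F i → ≤-resp-≈₂ (sym (column i)) (sym marginals) (cv∈F i))
      where
      column : ∀ i → dotCol Γ c' i ≈ dotCol Δ cv i
      column i = pairing-extension (λ F jF → A F jF i)
      marginals : dotT Γ c' n ≈ dotT Δ cv n
      marginals = pairing-extension (t n)

lemma6 : ∀ {c ℓ ℓ'} (R : OrderedCommRing c ℓ ℓ') {K : ℕ} (d : Fin K → ℕ)
    (Δ Γ : SimplicialComplex K) → Δ ⊑ Γ → (n : Tables.Table R d) →
    (cv : Tables.RowVec R d) →
    Tables.InF R d Δ n cv ⇔
      (Σ (Tables.RowVec R d) λ c' →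
        Tables.InF R d Γ n c'
        × (∀ F → face Γ F ≡ true → face Δ F ≡ false →
             ∀ jF → OrderedCommRing._≈_ R (c' F jF) (OrderedCommRing.0# R))
        × (∀ F → face Δ F ≡ true →
             ∀ jF → OrderedCommRing._≈_ R (c' F jF) (cv F jF)))
lemma6 R d Δ Γ Δ⊑Γ n cv = mk⇔
  (λ cv∈F → c₀ , Equivalence.from (InF-extension Δ Γ Δ⊑Γ c₀ cv c₀-zeroOn c₀-agreeOn n) cv∈F
                , c₀-zeroOn , c₀-agreeOn)
  (λ { (c' , c'∈F , zeroOn , agreeOn) →
          Equivalence.to (InF-extension Δ Γ Δ⊑Γ c' cv zeroOn agreeOn n) c'∈F })
  where
  open Pairing R d
  c₀ : Tables.RowVec R d
  c₀ = extendByZero Δ cv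
  c₀-zeroOn : (ZeroOn Γ ∖ Δ) c₀
  c₀-zeroOn = extendByZero-zeroOn Δ Γ cv
  c₀-agreeOn : AgreeOn Δ c₀ cv
  c₀-agreeOn = extendByZero-agreeOn Δ cv
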